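{- Let $G$ be a graph of order $n$ with maximum degree $\Delta$. If $n$ is even, then $c^A_g(G)\le \frac n2+2\Delta$ and $c^I_g(G)\le \frac n2+3\Delta$. If $n$ is odd, then $c^A_g(G)\le \frac n2+3\Delta$ and $c^I_g(G)\le \frac n2+2\Delta$.
   Context: The cordiality game on a finite simple graph $G$ is played by two players, Admirable (A) and Impish (I), who alternately select a not-yet-labeled vertex of $G$ until all vertices are labeled; Admirable labels each vertex she selects by $0$ and Impish labels each vertex he selects by $1$. Each edge receives the sum modulo $2$ of the labels of its endpoints. Let $e_0$ and $e_1$ be the numbers of edges labeled $0$ and $1$ at the end; the discrepancy is $d=|e_1-e_0|$. Admirable tries to minimize $d$ and Impish tries to maximize $d$. $c^A_g(G)$ is the value of $d$ under optimal play of both players when Admirable moves first, and $c^I_g(G)$ is the value under optimal play when Impish moves first. -}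

module Defs where

open import Data.Bool using (Bool; true; false; _xor_; _∧_; if_then_else_)
open import Data.Maybe using (Maybe; just; nothing; is-nothing; fromMaybe)
open import Data.Nat using (ℕ; zero; suc; _+_; _*_; _⊓_; _⊔_; _<ᵇ_; ∣_-_∣)
open import Data.Fin using (Fin; toℕ; _≟_)
open import Data.List using (List; []; _∷_; map; foldr; length; filterᵇ; allFin; cartesianProduct)
open import Data.Product using (_×_; _,_; proj₁; proj₂)
open import Relation.Nullary.Decidable using (⌊_⌋)
open import Relation.Binary.PropositionalEquality using (_≡_)

record Graph (n : ℕ) : Set where
  field
    adj    : Fin n → Fin n → Bool
    sym    : ∀ i j → adj i j ≡ adj j i
    irrefl : ∀ i → adj i i ≡ false
open Graph public

degree : ∀ {n} → Graph n → Fin n → ℕ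
degree G i = length (filterᵇ (adj G i) (allFin _))

maxDegree : ∀ {n} → Graph n → ℕ
maxDegree G = foldr _⊔_ 0 (map (degree G) (allFin _))

edges : ∀ {n} → Graph n → List (Fin n × Fin n)
edges {n} G = filterᵇ (λ p → (toℕ (proj₁ p) <ᵇ toℕ (proj₂ p)) ∧ adj G (proj₁ p) (proj₂ p))
                      (cartesianProduct (allFin n) (allFin n))

-- partial labelings; label false = 0 (Admirable), true = 1 (Impish)
Labeling : ℕ → Set
Labeling n = Fin n → Maybe Bool

emptyLab : ∀ {n} → Labeling n
emptyLab _ = nothing

setLab : ∀ {n} → Labeling n → Fin n → Bool → Labeling n
setLab ℓ v b w = if ⌊ w ≟ v ⌋ then just b else ℓ w

-- label of a vertex (only used when all vertices are labeled)
lab : ∀ {n} → Labeling n → Fin n → Bool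
lab ℓ v = fromMaybe false (ℓ v)

edgeLab : ∀ {n} → Labeling n → Fin n × Fin n → Bool
edgeLab ℓ (i , j) = lab ℓ i xor lab ℓ j

e₁ : ∀ {n} → Graph n → Labeling n → ℕ
e₁ G ℓ = length (filterᵇ (edgeLab ℓ) (edges G))

e₀ : ∀ {n} → Graph n → Labeling n → ℕ
e₀ G ℓ = length (edges G) Data.Nat.∸ e₁ G ℓ

discrepancy : ∀ {n} → Graph n → Labeling n → ℕ
discrepancy G ℓ = ∣ e₁ G ℓ - e₀ G ℓ ∣

data Player : Set where
  Admirable Impish : Player

other : Player → Player
other Admirable = Impish
other Impish    = Admirable

labelOf : Player → Bool
labelOf Admirable = false
labelOf Impish    = true

unlabeled : ∀ {n} → Labeling n → List (Fin n)
unlabeled ℓ = filterᵇ (λ v → is-nothing (ℓ v)) (allFin _)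

-- The fuel k bounds the number of remaining moves; starting from the empty
-- labeling with fuel n it is exact (each move labels one new vertex).
gameValue : ∀ {n} → Graph n → ℕ → Player → Labeling n → ℕ
gameValue G zero p ℓ = discrepancy G ℓ
gameValue G (suc k) p ℓ with unlabeled ℓ
... | [] = discrepancy G ℓ
... | v ∷ vs = combine p (f v) (map f vs)
  where
    f : _ → ℕ
    f w = gameValue G k (other p) (setLab ℓ w (labelOf p))
    combine : Player → ℕ → List ℕ → ℕ
    combine Admirable x xs = foldr _⊓_ x xs
    combine Impish    x xs = foldr _⊔_ x xs

cgA : ∀ {n} → Graph n → ℕ
cgA {n} G = gameValue G n Admirable emptyLab

cgI : ∀ {n} → Graph n → ℕ
cgI {n} G = gameValue G n Impish emptyLab

Even Odd : ℕ → Set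
Even n = Data.Nat._%_ n 2 ≡ 0
Odd  n = Data.Nat._%_ n 2 ≡ 1

{-# OPTIONS --safe #-}

-- Give label 0 the spin +1, label 1 the spin -1 and an unlabeled vertex the spin 0, and let the
-- potential Φ = Σᵢⱼ sᵢ aᵢⱼ sⱼ be the quadratic form of the adjacency matrix at the spin vector.
-- On a complete labeling every edge contributes +2 or -2 to Φ according to its label, so
-- Φ = 2 (e₀ - e₁) and twice the discrepancy is |Φ|. Labeling w with spin σ adds 2 σ t_w to Φ,
-- where the local field t_w = Σⱼ a_wj sⱼ has |t_w| ≤ Δ.
--
-- If Φ ≥ 0, Admirable labels an unlabeled vertex w of minimal local field, otherwise one of maximal
-- local field. When Impish answers with x, the round changes Φ by 2 (t_w - t_x) - 2 a_wx: the first
-- term has the sign opposite to Φ, and the whole change is at most 4Δ in absolute value. Hence Φ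
-- never rises above 4Δ, while its lower bound drops by at most 2 per round, the cost of an edge wx.
-- Starting from Φ = 0, after the n/2 rounds of an even game -(4Δ + n) ≤ Φ ≤ 4Δ. A last lone move of
-- Admirable costs another 2Δ, and Impish's opening move leaves Φ = 0 since all local fields vanish.

module Submission where

open import Defs renaming (sym to adj-sym)
open import Data.Bool using (Bool; true; false; _∧_; _xor_; T)
open import Data.Fin using (Fin; zero; suc; toℕ; _≟_)
open import Data.Fin.Properties using (toℕ-injective)
open import Data.Integer
  using (ℤ; +_; -[1+_]; -_; _+_; _-_; _*_; _⊖_; _≤_; _<_; 0ℤ; 1ℤ; -1ℤ; +≤+; -≤+; -≤-; ∣_∣)
open import Data.Integer.Properties
  using ( +-*-semiring; ≤-totalOrder; module ≤-Reasoning; _≤?_; ≤-refl; ≤-reflexive; ≤-trans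
        ; <⇒≤; ≰⇒>; +-comm; +-identityˡ; +-identityʳ; *-identityˡ; *-zeroʳ; *-distribʳ-+
        ; neg-distrib-+; neg-involutive; -1*i≡-i; neg-≤-pos; neg-mono-≤; drop‿+≤+; +-injective
        ; +-mono-≤; +-monoˡ-≤; +-monoʳ-≤; *-monoˡ-≤-nonNeg; i≤i+j; i≤j⇒i-j≤0
        ; m-n≡m⊖n; [1+m]⊖[1+n]≡m⊖n; ⊖-≥; ∣-i∣≡∣i∣; ∣i+j∣≤∣i∣+∣j∣; ∣i-j∣≤∣i∣+∣j∣; ∣i*j∣≡∣i∣*∣j∣)
open import Data.Integer.Tactic.RingSolver using (solve-∀)
open import Algebra.Properties.Semiring.Sum +-*-semiring
  using (sum-syntax; sum-cong-≗; sum-replicate-zero; ∑-distrib-+; ∑-comm; *-distribˡ-sum)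
open import Data.List
  using (List; []; _∷_; _++_; length; map; foldr; filterᵇ; tabulate; allFin; cartesianProduct)
open import Data.List.Extrema ≤-totalOrder
  using (argmin; argmax; argmin-all; argmax-all; f[argmin]≤f[xs]; f[xs]≤f[argmax])
open import Data.List.Membership.Propositional using (_∈_)
open import Data.List.Membership.Propositional.Properties
  using (∈-filter⁺; ∈-filter⁻; ∈-allFin; ∈-map⁻; foldr-selective)
open import Data.List.Properties
  using (filter-++; filter-all; length-filter; length-++; length-tabulate; map-tabulate; foldr-preservesᵒ)
open import Data.List.Relation.Unary.All as All using ()
open import Data.List.Relation.Unary.Any as Any using (Any; here; there)
open import Data.List.Relation.Unary.Any.Properties using (map⁺)
open import Data.Maybe using (Maybe; just; nothing; maybe; is-nothing)
open import Data.Nat as ℕ using (ℕ; zero; suc)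
open import Data.Nat.Properties as ℕ using (⊔-sel; m≤n⇒m⊓o≤n; m≤n⇒o⊓m≤n; m≤n⇒m≤n⊔o; m≤n⇒m≤o⊔n)
import Data.Nat.Tactic.RingSolver as ℕ-Solver
open import Data.Product using (∃-syntax; _×_; _,_; proj₁; proj₂)
open import Data.Sum using (_⊎_; inj₁; inj₂; [_,_])
open import Data.Unit using (tt)
open import Function using (_∘_; id)
open import Level using (Level)
open import Relation.Binary.PropositionalEquality
  using (_≡_; _≢_; _≗_; refl; sym; trans; cong; cong₂; subst; module ≡-Reasoning)
open import Relation.Nullary using (yes; no; contradiction)
open import Relation.Nullary.Decidable using (⌊_⌋; T?)

private
  variable
    a b : Level
    A : Set a
    B : Set b

-- Integers: indicators, spins, finite sums and absolute values

𝟙 : Bool → ℤ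
𝟙 true  = 1ℤ
𝟙 false = 0ℤ

𝟙-∧ : ∀ p q → 𝟙 (p ∧ q) ≡ 𝟙 p * 𝟙 q
𝟙-∧ true  q = sym (*-identityˡ (𝟙 q))
𝟙-∧ false q = refl

spin : Bool → ℤ
spin false = 1ℤ
spin true  = -1ℤ

spin-xor : ∀ p q → spin (p xor q) ≡ spin p * spin q
spin-xor false q     = sym (*-identityˡ (spin q))
spin-xor true  false = refl
spin-xor true  true  = refl

∣spin*i∣≡∣i∣ : ∀ p i → ∣ spin p * i ∣ ≡ ∣ i ∣
∣spin*i∣≡∣i∣ false i = cong ∣_∣ (*-identityˡ i)
∣spin*i∣≡∣i∣ true  i = trans (cong ∣_∣ (-1*i≡-i i)) (∣-i∣≡∣i∣ i)

δ : ∀ {n} → Fin n → Fin n → ℤ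
δ i j = 𝟙 ⌊ i ≟ j ⌋

δ-suc : ∀ {n} (i j : Fin n) → δ (suc i) (suc j) ≡ δ i j
δ-suc i j with i ≟ j
... | yes _ = refl
... | no  _ = refl

∑-δ : ∀ {n} (w : Fin n) (f : Fin n → ℤ) → ∑[ i < n ] (δ i w * f i) ≡ f w
∑-δ {suc n} zero f =
  trans (cong (_+_ (1ℤ * f zero)) (sum-replicate-zero n)) (trans (+-identityʳ _) (*-identityˡ (f zero)))
∑-δ {suc n} (suc w) f =
  trans (+-identityˡ _) (trans (sum-cong-≗ (λ i → cong (_* f (suc i)) (δ-suc i w))) (∑-δ w (f ∘ suc)))

∑-neg : ∀ {n} (f : Fin n → ℤ) → ∑[ i < n ] (- f i) ≡ - (∑[ i < n ] f i)
∑-neg {zero}  f = refl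
∑-neg {suc n} f = trans (cong (_+_ (- f zero)) (∑-neg (f ∘ suc))) (sym (neg-distrib-+ (f zero) _))

∑-mono-≤ : ∀ {n} {f g : Fin n → ℤ} → (∀ i → f i ≤ g i) → ∑[ i < n ] f i ≤ ∑[ i < n ] g i
∑-mono-≤ {zero}  f≤g = +≤+ ℕ.z≤n
∑-mono-≤ {suc n} f≤g = +-mono-≤ (f≤g zero) (∑-mono-≤ (f≤g ∘ suc))

∑∑-distrib-+ : ∀ {m n} (f g : Fin m → Fin n → ℤ) →
  ∑[ i < m ] ∑[ j < n ] (f i j + g i j) ≡ ∑[ i < m ] ∑[ j < n ] f i j + ∑[ i < m ] ∑[ j < n ] g i j
∑∑-distrib-+ {n = n} f g = trans (sum-cong-≗ (λ i → ∑-distrib-+ (f i) (g i)))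
                                 (∑-distrib-+ (λ i → ∑[ j < n ] f i j) (λ i → ∑[ j < n ] g i j))

𝟙-<ᵇ-connex : ∀ m n → m ≢ n → 𝟙 (m ℕ.<ᵇ n) + 𝟙 (n ℕ.<ᵇ m) ≡ 1ℤ
𝟙-<ᵇ-connex zero    zero    m≢n = contradiction refl m≢n
𝟙-<ᵇ-connex zero    (suc n) _   = refl
𝟙-<ᵇ-connex (suc m) zero    _   = refl
𝟙-<ᵇ-connex (suc m) (suc n) m≢n = 𝟙-<ᵇ-connex m n (m≢n ∘ cong suc)

∑∑-symmetric : ∀ {n} (T : Fin n → Fin n → ℤ) → (∀ i j → T i j ≡ T j i) → (∀ i → T i i ≡ 0ℤ) →
  ∑[ i < n ] ∑[ j < n ] T i j ≡ + 2 * ∑[ i < n ] ∑[ j < n ] (𝟙 (toℕ i ℕ.<ᵇ toℕ j) * T i j)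
∑∑-symmetric {n} T T-sym T-diag = begin
  ∑[ i < n ] ∑[ j < n ] T i j            ≡⟨ sum-cong-≗ (λ i → sum-cong-≗ (split i)) ⟩
  ∑[ i < n ] ∑[ j < n ] (U i j + U j i)  ≡⟨ ∑∑-distrib-+ U (λ i j → U j i) ⟩
  ∑U + ∑[ i < n ] ∑[ j < n ] U j i       ≡⟨ cong (_+_ ∑U) (∑-comm (λ i j → U j i)) ⟩
  ∑U + ∑U                                ≡⟨ double ∑U ⟩
  + 2 * ∑U                               ∎
  where
  open ≡-Reasoning
  U : Fin n → Fin n → ℤ
  U i j = 𝟙 (toℕ i ℕ.<ᵇ toℕ j) * T i j
  ∑U : ℤ
  ∑U = ∑[ i < n ] ∑[ j < n ] U i j
  double : ∀ x → x + x ≡ + 2 * x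
  double = solve-∀
  split : ∀ i j → T i j ≡ U i j + U j i
  split i j with i ≟ j
  ... | yes refl = trans (T-diag i) (sym (cong₂ _+_ U-diag U-diag))
    where
    U-diag : U i i ≡ 0ℤ
    U-diag = trans (cong (𝟙 (toℕ i ℕ.<ᵇ toℕ i) *_) (T-diag i)) (*-zeroʳ (𝟙 (toℕ i ℕ.<ᵇ toℕ i)))
  ... | no  i≢j  = begin
    T i j                        ≡⟨ *-identityˡ (T i j) ⟨
    1ℤ * T i j                   ≡⟨ cong (_* T i j) (𝟙-<ᵇ-connex (toℕ i) (toℕ j) (i≢j ∘ toℕ-injective)) ⟨
    (𝟙 i<j + 𝟙 j<i) * T i j      ≡⟨ *-distribʳ-+ (T i j) (𝟙 i<j) (𝟙 j<i) ⟩
    U i j + 𝟙 j<i * T i j        ≡⟨ cong (λ t → U i j + 𝟙 j<i * t) (T-sym i j) ⟩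
    U i j + U j i                ∎
    where
    i<j = toℕ i ℕ.<ᵇ toℕ j
    j<i = toℕ j ℕ.<ᵇ toℕ i

∣m⊖n∣≡∣m-n∣ : ∀ m n → ∣ m ⊖ n ∣ ≡ ℕ.∣ m - n ∣
∣m⊖n∣≡∣m-n∣ zero    zero    = refl
∣m⊖n∣≡∣m-n∣ zero    (suc n) = refl
∣m⊖n∣≡∣m-n∣ (suc m) zero    = refl
∣m⊖n∣≡∣m-n∣ (suc m) (suc n) = trans (cong ∣_∣ ([1+m]⊖[1+n]≡m⊖n m n)) (∣m⊖n∣≡∣m-n∣ m n)

∣+m-+n∣≡∣m-n∣ : ∀ m n → ∣ + m - + n ∣ ≡ ℕ.∣ m - n ∣
∣+m-+n∣≡∣m-n∣ m n = trans (cong ∣_∣ (m-n≡m⊖n m n)) (∣m⊖n∣≡∣m-n∣ m n)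

+[m∸n]≡+m-+n : ∀ {m n} → n ℕ.≤ m → + (m ℕ.∸ n) ≡ + m - + n
+[m∸n]≡+m-+n {m} {n} n≤m = trans (sym (⊖-≥ n≤m)) (sym (m-n≡m⊖n m n))

∣i∣≤n⇒-n≤i : ∀ {i n} → ∣ i ∣ ℕ.≤ n → - + n ≤ i
∣i∣≤n⇒-n≤i {+ _}                _           = neg-≤-pos
∣i∣≤n⇒-n≤i { -[1+ _ ]} {suc _} (ℕ.s≤s k≤n) = -≤- k≤n

∣i∣≤n⇒i≤n : ∀ {i n} → ∣ i ∣ ℕ.≤ n → i ≤ + n
∣i∣≤n⇒i≤n {+ _}       k≤n = +≤+ k≤n
∣i∣≤n⇒i≤n { -[1+ _ ]} _   = -≤+

-n≤i≤n⇒∣i∣≤n : ∀ {i n} → - + n ≤ i → i ≤ + n → ∣ i ∣ ℕ.≤ n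
-n≤i≤n⇒∣i∣≤n {+ _}            _    i≤n = drop‿+≤+ i≤n
-n≤i≤n⇒∣i∣≤n { -[1+ m ]} {n} -n≤i _   =
  drop‿+≤+ (subst (+ suc m ≤_) (neg-involutive (+ n)) (neg-mono-≤ -n≤i))

-- Lists: counting and extrema of folds

count-tabulate : ∀ {n} (p : A → Bool) (f : Fin n → A) →
  + length (filterᵇ p (tabulate f)) ≡ ∑[ i < n ] 𝟙 (p (f i))
count-tabulate {n = zero}  p f = refl
count-tabulate {n = suc n} p f with p (f zero)
... | true  = cong (_+_ 1ℤ) (count-tabulate p (f ∘ suc))
... | false = trans (count-tabulate p (f ∘ suc)) (sym (+-identityˡ _))

count-cartesianProduct : ∀ {m n} (p : A × B → Bool) (f : Fin m → A) (g : Fin n → B) →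
  + length (filterᵇ p (cartesianProduct (tabulate f) (tabulate g))) ≡ ∑[ i < m ] ∑[ j < n ] 𝟙 (p (f i , g j))
count-cartesianProduct {m = zero}      p f g = refl
count-cartesianProduct {m = suc m} {n} p f g = begin
  + length (filterᵇ p (row ++ rows))                    ≡⟨ cong (+_ ∘ length) (filter-++ (T? ∘ p) row rows) ⟩
  + length (filterᵇ p row ++ filterᵇ p rows)            ≡⟨ cong +_ (length-++ (filterᵇ p row)) ⟩
  + length (filterᵇ p row) + + length (filterᵇ p rows)  ≡⟨ cong₂ _+_ first-row rest ⟩
  ∑[ j < n ] 𝟙 (p (f zero , g j)) + ∑[ i < m ] ∑[ j < n ] 𝟙 (p (f (suc i) , g j)) ∎
  where
  open ≡-Reasoning
  row  = map (f zero ,_) (tabulate g)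
  rows = cartesianProduct (tabulate (f ∘ suc)) (tabulate g)
  first-row : + length (filterᵇ p row) ≡ ∑[ j < n ] 𝟙 (p (f zero , g j))
  first-row = trans (cong (+_ ∘ length ∘ filterᵇ p) (map-tabulate g (f zero ,_)))
                    (count-tabulate p (λ j → f zero , g j))
  rest : + length (filterᵇ p rows) ≡ ∑[ i < m ] ∑[ j < n ] 𝟙 (p (f (suc i) , g j))
  rest = count-cartesianProduct p (f ∘ suc) g

filterᵇ-filterᵇ : ∀ (p q : A → Bool) xs → filterᵇ q (filterᵇ p xs) ≡ filterᵇ (λ x → p x ∧ q x) xs
filterᵇ-filterᵇ p q []       = refl
filterᵇ-filterᵇ p q (x ∷ xs) with p x
... | false = filterᵇ-filterᵇ p q xs
... | true with q x
...   | true  = cong (x ∷_) (filterᵇ-filterᵇ p q xs)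
...   | false = filterᵇ-filterᵇ p q xs

nonempty-member : ∀ {xs : List A} {k} → length xs ≡ suc k → ∃[ x ] x ∈ xs
nonempty-member {xs = x ∷ _} _ = x , here refl

∈⇒length≢0 : ∀ {x : A} {xs} → x ∈ xs → length xs ≢ 0
∈⇒length≢0 (here _)  ()
∈⇒length≢0 (there _) ()

foldr-⊓-≤ : ∀ (f : A → ℕ) v vs {w} → w ∈ v ∷ vs → foldr ℕ._⊓_ (f v) (map f vs) ℕ.≤ f w
foldr-⊓-≤ f v vs {w} w∈ =
  foldr-preservesᵒ {P = ℕ._≤ f w} (λ x y → [ m≤n⇒m⊓o≤n y , m≤n⇒o⊓m≤n x ]) (f v) (map f vs) (candidate w∈)
  where
  candidate : w ∈ v ∷ vs → f v ℕ.≤ f w ⊎ Any (ℕ._≤ f w) (map f vs)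
  candidate (here refl)  = inj₁ ℕ.≤-refl
  candidate (there w∈vs) = inj₂ (map⁺ (Any.map (λ { refl → ℕ.≤-refl }) w∈vs))

≤-foldr-⊔ : ∀ (f : A → ℕ) {w xs} → w ∈ xs → f w ℕ.≤ foldr ℕ._⊔_ 0 (map f xs)
≤-foldr-⊔ f {w} {xs} w∈ =
  foldr-preservesᵒ {P = f w ℕ.≤_} (λ x y → [ m≤n⇒m≤n⊔o y , m≤n⇒m≤o⊔n x ]) 0 (map f xs)
                   (inj₂ (map⁺ (Any.map (λ { refl → ℕ.≤-refl }) w∈)))

foldr-⊔-attained : ∀ (f : A → ℕ) v vs → ∃[ x ] x ∈ v ∷ vs × foldr ℕ._⊔_ (f v) (map f vs) ≡ f x
foldr-⊔-attained f v vs with foldr-selective ⊔-sel (f v) (map f vs)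
... | inj₁ eq  = v , here refl , eq
... | inj₂ ∈fs with ∈-map⁻ f ∈fs
...   | x , x∈vs , eq = x , there x∈vs , eq

-- Quadratic forms

addAt : ∀ {n} → (Fin n → ℤ) → Fin n → ℤ → Fin n → ℤ
addAt s w c i = s i + δ i w * c

module _ {n : ℕ} (A : Fin n → Fin n → ℤ) where

  mulVec : (Fin n → ℤ) → Fin n → ℤ
  mulVec s i = ∑[ j < n ] (A i j * s j)

  quadForm : (Fin n → ℤ) → ℤ
  quadForm s = ∑[ i < n ] (s i * mulVec s i)

  mulVec-cong : ∀ {s t} → s ≗ t → ∀ i → mulVec s i ≡ mulVec t i
  mulVec-cong s≗t i = sum-cong-≗ (λ j → cong (A i j *_) (s≗t j))

  quadForm-cong : ∀ {s t} → s ≗ t → quadForm s ≡ quadForm t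
  quadForm-cong s≗t = sum-cong-≗ (λ i → cong₂ _*_ (s≗t i) (mulVec-cong s≗t i))

  mulVec-addAt : ∀ s w c i → mulVec (addAt s w c) i ≡ mulVec s i + A i w * c
  mulVec-addAt s w c i = begin
    ∑[ j < n ] (A i j * (s j + δ j w * c))          ≡⟨ sum-cong-≗ (λ j → expand (A i j) (s j) (δ j w) c) ⟩
    ∑[ j < n ] (A i j * s j + δ j w * (A i j * c))  ≡⟨ ∑-distrib-+ (λ j → A i j * s j) moved ⟩
    mulVec s i + ∑[ j < n ] moved j                 ≡⟨ cong (_+_ (mulVec s i)) (∑-δ w (λ j → A i j * c)) ⟩
    mulVec s i + A i w * c                          ∎
    where
    open ≡-Reasoning
    moved : Fin n → ℤ
    moved j = δ j w * (A i j * c)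
    expand : ∀ a x d c → a * (x + d * c) ≡ a * x + d * (a * c)
    expand = solve-∀

  quadForm-addAt : (∀ i j → A i j ≡ A j i) → ∀ s w c → A w w ≡ 0ℤ →
    quadForm (addAt s w c) ≡ quadForm s + + 2 * (c * mulVec s w)
  quadForm-addAt A-sym s w c A-ww≡0 = begin
    ∑[ i < n ] ((s i + δ i w * c) * mulVec (addAt s w c) i)
      ≡⟨ sum-cong-≗ (λ i → cong ((s i + δ i w * c) *_) (t′ i)) ⟩
    ∑[ i < n ] ((s i + δ i w * c) * (t i + A w i * c))
      ≡⟨ sum-cong-≗ (λ i → expand (s i) (t i) (δ i w) c (A w i)) ⟩
    ∑[ i < n ] (kept i + moved i)
      ≡⟨ ∑-distrib-+ kept moved ⟩
    ∑[ i < n ] kept i + ∑[ i < n ] moved i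
      ≡⟨ cong₂ _+_ kept≡ (∑-δ w (λ i → c * t i + A w i * c * c)) ⟩
    (quadForm s + c * t w) + (c * t w + A w w * c * c)
      ≡⟨ cong (λ a → (quadForm s + c * t w) + (c * t w + a * c * c)) A-ww≡0 ⟩
    (quadForm s + c * t w) + (c * t w + 0ℤ * c * c)
      ≡⟨ collect (quadForm s) (c * t w) c ⟩
    quadForm s + + 2 * (c * t w)
      ∎
    where
    open ≡-Reasoning
    t = mulVec s
    t′ : ∀ i → mulVec (addAt s w c) i ≡ t i + A w i * c
    t′ i = trans (mulVec-addAt s w c i) (cong (λ a → t i + a * c) (A-sym i w))
    kept moved : Fin n → ℤ
    kept i  = s i * t i + c * (A w i * s i)
    moved i = δ i w * (c * t i + A w i * c * c)
    kept≡ : ∑[ i < n ] kept i ≡ quadForm s + c * t w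
    kept≡ = trans (∑-distrib-+ (λ i → s i * t i) (λ i → c * (A w i * s i)))
                  (cong (_+_ (quadForm s)) (sym (*-distribˡ-sum c (λ i → A w i * s i))))
    expand : ∀ x y d c a → (x + d * c) * (y + a * c) ≡ (x * y + c * (a * x)) + d * (c * y + a * c * c)
    expand = solve-∀
    collect : ∀ q x c → (q + x) + (x + 0ℤ * c * c) ≡ q + + 2 * x
    collect = solve-∀

-- Labelings and game values

Complete : ∀ {n} → Labeling n → Set
Complete ℓ = ∀ i → ℓ i ≢ nothing

module _ {n : ℕ} where

  ∈-unlabeled⁺ : ∀ (ℓ : Labeling n) {x} → ℓ x ≡ nothing → x ∈ unlabeled ℓ
  ∈-unlabeled⁺ ℓ {x} ℓx≡nothing =
    ∈-filter⁺ (T? ∘ is-nothing ∘ ℓ) (∈-allFin x) (subst (T ∘ is-nothing) (sym ℓx≡nothing) tt)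

  ∈-unlabeled⁻ : ∀ (ℓ : Labeling n) {x} → x ∈ unlabeled ℓ → ℓ x ≡ nothing
  ∈-unlabeled⁻ ℓ x∈ = T-is-nothing (proj₂ (∈-filter⁻ (T? ∘ is-nothing ∘ ℓ) {xs = allFin n} x∈))
    where
    T-is-nothing : ∀ {m : Maybe Bool} → T (is-nothing m) → m ≡ nothing
    T-is-nothing {nothing} _ = refl

  unlabeled-vertex : ∀ (ℓ : Labeling n) {k} → length (unlabeled ℓ) ≡ suc k → ∃[ u ] ℓ u ≡ nothing
  unlabeled-vertex ℓ #ℓ with nonempty-member #ℓ
  ... | u , u∈ = u , ∈-unlabeled⁻ ℓ u∈

  length-unlabeled≡0⇒complete : ∀ (ℓ : Labeling n) → length (unlabeled ℓ) ≡ 0 → Complete ℓ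
  length-unlabeled≡0⇒complete ℓ #ℓ i ℓi≡nothing = ∈⇒length≢0 (∈-unlabeled⁺ ℓ ℓi≡nothing) #ℓ

  length-unlabeled-emptyLab : length (unlabeled (emptyLab {n})) ≡ n
  length-unlabeled-emptyLab =
    trans (cong length (filter-all (T? ∘ λ _ → true) (All.universal (λ _ → tt) (allFin n))))
          (length-tabulate id)

  length-unlabeled-setLab : ∀ (ℓ : Labeling n) {w k} b → ℓ w ≡ nothing →
    length (unlabeled ℓ) ≡ suc k → length (unlabeled (setLab ℓ w b)) ≡ k
  length-unlabeled-setLab ℓ {w} b ℓw≡nothing #ℓ = ℕ.suc-injective (trans (sym (+-injective count≡)) #ℓ)
    where
    open ≡-Reasoning
    ℓ′ = setLab ℓ w b
    unlabeled′ : Fin n → ℤ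
    unlabeled′ i = 𝟙 (is-nothing (ℓ′ i))
    ∑unlabeled′ : ℤ
    ∑unlabeled′ = ∑[ i < n ] unlabeled′ i
    split : ∀ i → 𝟙 (is-nothing (ℓ i)) ≡ δ i w * 1ℤ + unlabeled′ i
    split i with i ≟ w
    ... | yes refl = cong (𝟙 ∘ is-nothing) ℓw≡nothing
    ... | no  _    = sym (+-identityˡ _)
    count≡ : + length (unlabeled ℓ) ≡ 1ℤ + + length (unlabeled ℓ′)
    count≡ = begin
      + length (unlabeled ℓ)                  ≡⟨ count-tabulate (is-nothing ∘ ℓ) id ⟩
      ∑[ i < n ] 𝟙 (is-nothing (ℓ i))         ≡⟨ sum-cong-≗ split ⟩
      ∑[ i < n ] (δ i w * 1ℤ + unlabeled′ i)  ≡⟨ ∑-distrib-+ (λ i → δ i w * 1ℤ) unlabeled′ ⟩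
      ∑[ i < n ] (δ i w * 1ℤ) + ∑unlabeled′   ≡⟨ cong (_+ ∑unlabeled′) (∑-δ w (λ _ → 1ℤ)) ⟩
      1ℤ + ∑unlabeled′                        ≡⟨ cong (_+_ 1ℤ) (count-tabulate (is-nothing ∘ ℓ′) id) ⟨
      1ℤ + + length (unlabeled ℓ′)            ∎

  setLab-unlabeled⁻ : ∀ (ℓ : Labeling n) w b x → setLab ℓ w b x ≡ nothing → ℓ x ≡ nothing
  setLab-unlabeled⁻ ℓ w b x with x ≟ w
  ... | yes _ = λ ()
  ... | no  _ = id

  argmin-unlabeled : ∀ (g : Fin n → ℤ) ℓ {u} → ℓ u ≡ nothing →
    ∃[ w ] ℓ w ≡ nothing × (∀ x → ℓ x ≡ nothing → g w ≤ g x)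
  argmin-unlabeled g ℓ {u} ℓu≡nothing =
    argmin g u (unlabeled ℓ) ,
    argmin-all g {P = λ v → ℓ v ≡ nothing} ℓu≡nothing (All.tabulate (∈-unlabeled⁻ ℓ)) ,
    λ x ℓx≡nothing → All.lookup (f[argmin]≤f[xs] u (unlabeled ℓ)) (∈-unlabeled⁺ ℓ ℓx≡nothing)

  argmax-unlabeled : ∀ (g : Fin n → ℤ) ℓ {u} → ℓ u ≡ nothing →
    ∃[ w ] ℓ w ≡ nothing × (∀ x → ℓ x ≡ nothing → g x ≤ g w)
  argmax-unlabeled g ℓ {u} ℓu≡nothing =
    argmax g u (unlabeled ℓ) ,
    argmax-all g {P = λ v → ℓ v ≡ nothing} ℓu≡nothing (All.tabulate (∈-unlabeled⁻ ℓ)) ,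
    λ x ℓx≡nothing → All.lookup (f[xs]≤f[argmax] u (unlabeled ℓ)) (∈-unlabeled⁺ ℓ ℓx≡nothing)

module _ {n : ℕ} (G : Graph n) where

  gameValue-Admirable-≤ : ∀ k ℓ {w} → ℓ w ≡ nothing →
    gameValue G (suc k) Admirable ℓ ℕ.≤ gameValue G k Impish (setLab ℓ w false)
  gameValue-Admirable-≤ k ℓ ℓw≡nothing with unlabeled ℓ | ∈-unlabeled⁺ ℓ ℓw≡nothing
  ... | v ∷ vs | w∈ = foldr-⊓-≤ (λ x → gameValue G k Impish (setLab ℓ x false)) v vs w∈

  gameValue-Impish-attained : ∀ k ℓ {u} → ℓ u ≡ nothing →
    ∃[ x ] ℓ x ≡ nothing × gameValue G (suc k) Impish ℓ ≡ gameValue G k Admirable (setLab ℓ x true)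
  gameValue-Impish-attained k ℓ ℓu≡nothing
    with unlabeled ℓ | ∈-unlabeled⁺ ℓ ℓu≡nothing | (λ {x} → ∈-unlabeled⁻ ℓ {x})
  ... | v ∷ vs | _ | unlabeled⇒
    with foldr-⊔-attained (λ x → gameValue G k Admirable (setLab ℓ x true)) v vs
  ...   | x , x∈ , value≡ = x , unlabeled⇒ x∈ , value≡

-- The potential of a labeling

module Potential {n : ℕ} (G : Graph n) where

  adjacency : Fin n → Fin n → ℤ
  adjacency i j = 𝟙 (adj G i j)

  spins : Labeling n → Fin n → ℤ
  spins ℓ i = maybe spin 0ℤ (ℓ i)

  localField : Labeling n → Fin n → ℤ
  localField ℓ = mulVec adjacency (spins ℓ)

  potential : Labeling n → ℤ
  potential ℓ = quadForm adjacency (spins ℓ)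

  adjacency-sym : ∀ i j → adjacency i j ≡ adjacency j i
  adjacency-sym i j = cong 𝟙 (adj-sym G i j)

  spins-setLab : ∀ ℓ {w} b → ℓ w ≡ nothing → spins (setLab ℓ w b) ≗ addAt (spins ℓ) w (spin b)
  spins-setLab ℓ {w} b ℓw≡nothing i with i ≟ w
  ... | yes refl rewrite ℓw≡nothing = sym (trans (+-identityˡ _) (*-identityˡ (spin b)))
  ... | no  _    = sym (+-identityʳ _)

  spins-complete : ∀ ℓ → Complete ℓ → ∀ i → spins ℓ i ≡ spin (lab ℓ i)
  spins-complete ℓ complete i with ℓ i | complete i
  ... | nothing | ℓi≢nothing = contradiction refl ℓi≢nothing
  ... | just _  | _          = refl

  localField-setLab : ∀ ℓ {w} b → ℓ w ≡ nothing → ∀ x →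
    localField (setLab ℓ w b) x ≡ localField ℓ x + adjacency x w * spin b
  localField-setLab ℓ {w} b ℓw≡nothing x =
    trans (mulVec-cong adjacency (spins-setLab ℓ b ℓw≡nothing) x)
          (mulVec-addAt adjacency (spins ℓ) w (spin b) x)

  localField-setLab-false : ∀ ℓ {w} → ℓ w ≡ nothing → ∀ x →
    localField ℓ x ≤ localField (setLab ℓ w false) x × localField (setLab ℓ w false) x ≤ localField ℓ x + 1ℤ
  localField-setLab-false ℓ {w} ℓw≡nothing x rewrite localField-setLab ℓ false ℓw≡nothing x with adj G x w
  ... | true  = i≤i+j (localField ℓ x) 1ℤ , ≤-refl
  ... | false = i≤i+j (localField ℓ x) 0ℤ , +-monoʳ-≤ (localField ℓ x) (+≤+ ℕ.z≤n)

  localField-emptyLab : ∀ x → localField emptyLab x ≡ 0ℤ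
  localField-emptyLab x = trans (sum-cong-≗ (λ j → *-zeroʳ (adjacency x j))) (sum-replicate-zero n)

  ∣localField∣≤maxDegree : ∀ ℓ x → ∣ localField ℓ x ∣ ℕ.≤ maxDegree G
  ∣localField∣≤maxDegree ℓ x = ℕ.≤-trans (-n≤i≤n⇒∣i∣≤n lower upper) (≤-foldr-⊔ (degree G) (∈-allFin x))
    where
    degree≡ : + degree G x ≡ ∑[ j < n ] adjacency x j
    degree≡ = count-tabulate (adj G x) id
    bounds : ∀ p m → - 𝟙 p ≤ 𝟙 p * maybe spin 0ℤ m × 𝟙 p * maybe spin 0ℤ m ≤ 𝟙 p
    bounds false _            = +≤+ ℕ.z≤n , +≤+ ℕ.z≤n
    bounds true  nothing      = -≤+ , +≤+ ℕ.z≤n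
    bounds true  (just false) = -≤+ , +≤+ (ℕ.s≤s ℕ.z≤n)
    bounds true  (just true)  = -≤- ℕ.z≤n , -≤+
    upper : localField ℓ x ≤ + degree G x
    upper = subst (localField ℓ x ≤_) (sym degree≡) (∑-mono-≤ (λ j → proj₂ (bounds (adj G x j) (ℓ j))))
    lower : - + degree G x ≤ localField ℓ x
    lower = subst (_≤ localField ℓ x) (trans (∑-neg (adjacency x)) (cong -_ (sym degree≡)))
                  (∑-mono-≤ (λ j → proj₁ (bounds (adj G x j) (ℓ j))))

  potential-setLab : ∀ ℓ {w} b → ℓ w ≡ nothing →
    potential (setLab ℓ w b) ≡ potential ℓ + + 2 * (spin b * localField ℓ w)
  potential-setLab ℓ {w} b ℓw≡nothing =
    trans (quadForm-cong adjacency (spins-setLab ℓ b ℓw≡nothing))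
          (quadForm-addAt adjacency adjacency-sym (spins ℓ) w (spin b) (cong 𝟙 (irrefl G w)))

  potential-emptyLab : potential emptyLab ≡ 0ℤ
  potential-emptyLab = sum-replicate-zero n

  potential-setLab-emptyLab : ∀ x b → potential (setLab emptyLab x b) ≡ 0ℤ
  potential-setLab-emptyLab x b =
    trans (potential-setLab emptyLab b refl)
          (cong₂ (λ Φ p → Φ + + 2 * p) potential-emptyLab
                 (trans (cong (spin b *_) (localField-emptyLab x)) (*-zeroʳ (spin b))))

  ∣potential-setLab∣≤ : ∀ ℓ {w} b → ℓ w ≡ nothing →
    ∣ potential (setLab ℓ w b) ∣ ℕ.≤ ∣ potential ℓ ∣ ℕ.+ 2 ℕ.* maxDegree G
  ∣potential-setLab∣≤ ℓ {w} b ℓw≡nothing = begin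
    ∣ potential (setLab ℓ w b) ∣                      ≡⟨ cong ∣_∣ (potential-setLab ℓ b ℓw≡nothing) ⟩
    ∣ potential ℓ + + 2 * σt ∣                        ≤⟨ ∣i+j∣≤∣i∣+∣j∣ (potential ℓ) (+ 2 * σt) ⟩
    ∣ potential ℓ ∣ ℕ.+ ∣ + 2 * σt ∣                  ≡⟨ cong (∣ potential ℓ ∣ ℕ.+_) ∣2σt∣≡ ⟩
    ∣ potential ℓ ∣ ℕ.+ 2 ℕ.* ∣ localField ℓ w ∣      ≤⟨ ℕ.+-monoʳ-≤ ∣ potential ℓ ∣
                                                          (ℕ.*-monoʳ-≤ 2 (∣localField∣≤maxDegree ℓ w)) ⟩
    ∣ potential ℓ ∣ ℕ.+ 2 ℕ.* maxDegree G             ∎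
    where
    open ℕ.≤-Reasoning
    σt = spin b * localField ℓ w
    ∣2σt∣≡ : ∣ + 2 * σt ∣ ≡ 2 ℕ.* ∣ localField ℓ w ∣
    ∣2σt∣≡ = trans (∣i*j∣≡∣i∣*∣j∣ (+ 2) σt) (cong (2 ℕ.*_) (∣spin*i∣≡∣i∣ b (localField ℓ w)))

  potential-round : ∀ ℓ {w x} → ℓ w ≡ nothing → setLab ℓ w false x ≡ nothing →
    potential (setLab (setLab ℓ w false) x true)
      ≡ potential ℓ + + 2 * (localField ℓ w - localField (setLab ℓ w false) x)
  potential-round ℓ {w} {x} ℓw≡nothing ℓ₁x≡nothing = begin
    potential (setLab ℓ₁ x true)
      ≡⟨ potential-setLab ℓ₁ true ℓ₁x≡nothing ⟩
    potential ℓ₁ + + 2 * (-1ℤ * t₁x)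
      ≡⟨ cong (_+ + 2 * (-1ℤ * t₁x)) (potential-setLab ℓ false ℓw≡nothing) ⟩
    (potential ℓ + + 2 * (1ℤ * tw)) + + 2 * (-1ℤ * t₁x)
      ≡⟨ rearrange (potential ℓ) tw t₁x ⟩
    potential ℓ + + 2 * (tw - t₁x)
      ∎
    where
    open ≡-Reasoning
    ℓ₁  = setLab ℓ w false
    tw  = localField ℓ w
    t₁x = localField ℓ₁ x
    rearrange : ∀ Φ p q → (Φ + + 2 * (1ℤ * p)) + + 2 * (-1ℤ * q) ≡ Φ + + 2 * (p - q)
    rearrange = solve-∀

  ∣round-increment∣≤ : ∀ ℓ w x ℓ′ → ∣ + 2 * (localField ℓ w - localField ℓ′ x) ∣ ℕ.≤ 4 ℕ.* maxDegree G
  ∣round-increment∣≤ ℓ w x ℓ′ = begin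
    ∣ + 2 * (tw - t′x) ∣        ≡⟨ ∣i*j∣≡∣i∣*∣j∣ (+ 2) (tw - t′x) ⟩
    2 ℕ.* ∣ tw - t′x ∣          ≤⟨ ℕ.*-monoʳ-≤ 2 (∣i-j∣≤∣i∣+∣j∣ tw t′x) ⟩
    2 ℕ.* (∣ tw ∣ ℕ.+ ∣ t′x ∣)  ≤⟨ ℕ.*-monoʳ-≤ 2 (ℕ.+-mono-≤ (∣localField∣≤maxDegree ℓ w)
                                                          (∣localField∣≤maxDegree ℓ′ x)) ⟩
    2 ℕ.* (Δ ℕ.+ Δ)             ≡⟨ double Δ ⟩
    4 ℕ.* Δ                     ∎
    where
    open ℕ.≤-Reasoning
    Δ   = maxDegree G
    tw  = localField ℓ w
    t′x = localField ℓ′ x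
    double : ∀ D → 2 ℕ.* (D ℕ.+ D) ≡ 4 ℕ.* D
    double = ℕ-Solver.solve-∀

  isEdge : Fin n → Fin n → Bool
  isEdge i j = (toℕ i ℕ.<ᵇ toℕ j) ∧ adj G i j

  e₀-e₁-as-sum : ∀ ℓ → + e₀ G ℓ - + e₁ G ℓ ≡ ∑[ i < n ] ∑[ j < n ] (𝟙 (isEdge i j) * spin (edgeLab ℓ (i , j)))
  e₀-e₁-as-sum ℓ = begin
    + (length (edges G) ℕ.∸ e₁ G ℓ) - + e₁ G ℓ  ≡⟨ cong (_- + e₁ G ℓ) (+[m∸n]≡+m-+n e₁≤#edges) ⟩
    (+ length (edges G) - + e₁ G ℓ) - + e₁ G ℓ  ≡⟨ cong₂ (λ x y → (x - y) - y) #edges #1-edges ⟩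
    (((S + C) + C) - C) - C                      ≡⟨ cancel S C ⟩
    S                                            ∎
    where
    open ≡-Reasoning
    edge? : Fin n × Fin n → Bool
    edge? (i , j) = isEdge i j
    Sᵢⱼ Cᵢⱼ : Fin n → Fin n → ℤ
    Sᵢⱼ i j = 𝟙 (isEdge i j) * spin (edgeLab ℓ (i , j))
    Cᵢⱼ i j = 𝟙 (isEdge i j ∧ edgeLab ℓ (i , j))
    S C : ℤ
    S = ∑[ i < n ] ∑[ j < n ] Sᵢⱼ i j
    C = ∑[ i < n ] ∑[ j < n ] Cᵢⱼ i j
    e₁≤#edges : e₁ G ℓ ℕ.≤ length (edges G)
    e₁≤#edges = length-filter (T? ∘ edgeLab ℓ) (edges G)
    cancel : ∀ s c → (((s + c) + c) - c) - c ≡ s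
    cancel = solve-∀
    split : ∀ p q → 𝟙 p ≡ (𝟙 p * spin q + 𝟙 (p ∧ q)) + 𝟙 (p ∧ q)
    split false _     = refl
    split true  false = refl
    split true  true  = refl
    #edges : + length (edges G) ≡ (S + C) + C
    #edges = begin
      + length (edges G)
        ≡⟨ count-cartesianProduct edge? id id ⟩
      ∑[ i < n ] ∑[ j < n ] 𝟙 (isEdge i j)
        ≡⟨ sum-cong-≗ (λ i → sum-cong-≗ (λ j → split (isEdge i j) (edgeLab ℓ (i , j)))) ⟩
      ∑[ i < n ] ∑[ j < n ] ((Sᵢⱼ i j + Cᵢⱼ i j) + Cᵢⱼ i j)
        ≡⟨ ∑∑-distrib-+ (λ i j → Sᵢⱼ i j + Cᵢⱼ i j) Cᵢⱼ ⟩
      ∑[ i < n ] ∑[ j < n ] (Sᵢⱼ i j + Cᵢⱼ i j) + C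
        ≡⟨ cong (_+ C) (∑∑-distrib-+ Sᵢⱼ Cᵢⱼ) ⟩
      (S + C) + C
        ∎
    #1-edges : + e₁ G ℓ ≡ C
    #1-edges =
      trans (cong (+_ ∘ length) (filterᵇ-filterᵇ edge? (edgeLab ℓ) (cartesianProduct (allFin n) (allFin n))))
            (count-cartesianProduct (λ p → edge? p ∧ edgeLab ℓ p) id id)

  potential-complete : ∀ ℓ → Complete ℓ → potential ℓ ≡ + 2 * (+ e₀ G ℓ - + e₁ G ℓ)
  potential-complete ℓ complete = begin
    potential ℓ
      ≡⟨ sum-cong-≗ (λ i → *-distribˡ-sum (spins ℓ i) (λ j → adjacency i j * spins ℓ j)) ⟩
    ∑[ i < n ] ∑[ j < n ] E i j
      ≡⟨ ∑∑-symmetric E E-sym E-diag ⟩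
    + 2 * ∑[ i < n ] ∑[ j < n ] (𝟙 (toℕ i ℕ.<ᵇ toℕ j) * E i j)
      ≡⟨ cong (+ 2 *_) (sum-cong-≗ (λ i → sum-cong-≗ (edge-term i))) ⟩
    + 2 * ∑[ i < n ] ∑[ j < n ] (𝟙 (isEdge i j) * spin (edgeLab ℓ (i , j)))
      ≡⟨ cong (+ 2 *_) (e₀-e₁-as-sum ℓ) ⟨
    + 2 * (+ e₀ G ℓ - + e₁ G ℓ)
      ∎
    where
    open ≡-Reasoning
    E : Fin n → Fin n → ℤ
    E i j = spins ℓ i * (adjacency i j * spins ℓ j)
    swap : ∀ x p y → x * (p * y) ≡ y * (p * x)
    swap = solve-∀
    E-sym : ∀ i j → E i j ≡ E j i
    E-sym i j = trans (swap (spins ℓ i) (adjacency i j) (spins ℓ j))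
                      (cong (λ p → spins ℓ j * (p * spins ℓ i)) (adjacency-sym i j))
    E-diag : ∀ i → E i i ≡ 0ℤ
    E-diag i = trans (cong (λ p → spins ℓ i * (𝟙 p * spins ℓ i)) (irrefl G i)) (*-zeroʳ (spins ℓ i))
    regroup : ∀ p x q y → p * (x * (q * y)) ≡ (p * q) * (x * y)
    regroup = solve-∀
    edge-term : ∀ i j → 𝟙 (toℕ i ℕ.<ᵇ toℕ j) * E i j ≡ 𝟙 (isEdge i j) * spin (edgeLab ℓ (i , j))
    edge-term i j = begin
      𝟙 i<j * (spins ℓ i * (adjacency i j * spins ℓ j))
        ≡⟨ cong₂ (λ x y → 𝟙 i<j * (x * (adjacency i j * y)))
                 (spins-complete ℓ complete i) (spins-complete ℓ complete j) ⟩
      𝟙 i<j * (spin (lab ℓ i) * (adjacency i j * spin (lab ℓ j)))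
        ≡⟨ regroup (𝟙 i<j) (spin (lab ℓ i)) (adjacency i j) (spin (lab ℓ j)) ⟩
      (𝟙 i<j * adjacency i j) * (spin (lab ℓ i) * spin (lab ℓ j))
        ≡⟨ cong₂ _*_ (𝟙-∧ i<j (adj G i j)) (spin-xor (lab ℓ i) (lab ℓ j)) ⟨
      𝟙 (isEdge i j) * spin (edgeLab ℓ (i , j))
        ∎
      where
      i<j = toℕ i ℕ.<ᵇ toℕ j

  double-discrepancy : ∀ ℓ → Complete ℓ → 2 ℕ.* discrepancy G ℓ ≡ ∣ potential ℓ ∣
  double-discrepancy ℓ complete = begin
    2 ℕ.* ℕ.∣ e₁ G ℓ - e₀ G ℓ ∣      ≡⟨ cong (2 ℕ.*_) (ℕ.∣-∣-comm (e₁ G ℓ) (e₀ G ℓ)) ⟩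
    2 ℕ.* ℕ.∣ e₀ G ℓ - e₁ G ℓ ∣      ≡⟨ cong (2 ℕ.*_) (∣+m-+n∣≡∣m-n∣ (e₀ G ℓ) (e₁ G ℓ)) ⟨
    2 ℕ.* ∣ + e₀ G ℓ - + e₁ G ℓ ∣    ≡⟨ ∣i*j∣≡∣i∣*∣j∣ (+ 2) (+ e₀ G ℓ - + e₁ G ℓ) ⟨
    ∣ + 2 * (+ e₀ G ℓ - + e₁ G ℓ) ∣  ≡⟨ cong ∣_∣ (potential-complete ℓ complete) ⟨
    ∣ potential ℓ ∣                  ∎
    where open ≡-Reasoning

-- Admirable's strategy

j≤i+1⇒-1≤i-j : ∀ {i j} → j ≤ i + 1ℤ → -1ℤ ≤ i - j
j≤i+1⇒-1≤i-j {i} j≤i+1 = ≤-trans (≤-reflexive (sym (cancel i))) (+-monoʳ-≤ i (neg-mono-≤ j≤i+1))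
  where
  cancel : ∀ i → i + - (i + 1ℤ) ≡ -1ℤ
  cancel = solve-∀

window-step : ∀ {K m Φ d} → m ℕ.≤ K → - + K ≤ Φ → Φ ≤ + m → ∣ d ∣ ℕ.≤ m →
  (0ℤ ≤ Φ × d ≤ 0ℤ) ⊎ (Φ < 0ℤ × - + 2 ≤ d) → - + (2 ℕ.+ K) ≤ Φ + d × Φ + d ≤ + m
window-step {K} {m} {Φ} {d} m≤K _ Φ≤m ∣d∣≤m (inj₁ (0≤Φ , d≤0)) = lower , upper
  where
  open ≤-Reasoning
  lower : - + (2 ℕ.+ K) ≤ Φ + d
  lower = begin
    - + (2 ℕ.+ K)  ≤⟨ neg-mono-≤ (+≤+ (ℕ.≤-trans m≤K (ℕ.m≤n+m K 2))) ⟩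
    - + m          ≤⟨ ∣i∣≤n⇒-n≤i ∣d∣≤m ⟩
    d              ≡⟨ +-identityˡ d ⟨
    0ℤ + d         ≤⟨ +-monoˡ-≤ d 0≤Φ ⟩
    Φ + d          ∎
  upper : Φ + d ≤ + m
  upper = begin
    Φ + d   ≤⟨ +-monoʳ-≤ Φ d≤0 ⟩
    Φ + 0ℤ  ≡⟨ +-identityʳ Φ ⟩
    Φ       ≤⟨ Φ≤m ⟩
    + m     ∎
window-step {K} {m} {Φ} {d} _ -K≤Φ _ ∣d∣≤m (inj₂ (Φ<0 , -2≤d)) = lower , upper
  where
  open ≤-Reasoning
  lower : - + (2 ℕ.+ K) ≤ Φ + d
  lower = begin
    - + (2 ℕ.+ K)  ≡⟨ neg-distrib-+ (+ 2) (+ K) ⟩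
    - + 2 + - + K  ≡⟨ +-comm (- + 2) (- + K) ⟩
    - + K + - + 2  ≤⟨ +-mono-≤ -K≤Φ -2≤d ⟩
    Φ + d          ∎
  upper : Φ + d ≤ + m
  upper = begin
    Φ + d   ≤⟨ +-monoˡ-≤ d (<⇒≤ Φ<0) ⟩
    0ℤ + d  ≡⟨ +-identityˡ d ⟩
    d       ≤⟨ ∣i∣≤n⇒i≤n ∣d∣≤m ⟩
    + m     ∎

module Strategy {n : ℕ} (G : Graph n) where

  open Potential G

  Δ : ℕ
  Δ = maxDegree G

  record Window (K : ℕ) (ℓ : Labeling n) : Set where
    field
      wide  : 4 ℕ.* Δ ℕ.≤ K
      lower : - + K ≤ potential ℓ
      upper : potential ℓ ≤ + (4 ℕ.* Δ)

  window-start : ∀ ℓ → potential ℓ ≡ 0ℤ → Window (4 ℕ.* Δ) ℓ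
  window-start ℓ Φ≡0 = record
    { wide  = ℕ.≤-refl
    ; lower = subst (- + (4 ℕ.* Δ) ≤_) (sym Φ≡0) neg-≤-pos
    ; upper = subst (_≤ + (4 ℕ.* Δ)) (sym Φ≡0) (+≤+ ℕ.z≤n)
    }

  ∣potential∣≤ : ∀ {K ℓ} → Window K ℓ → ∣ potential ℓ ∣ ℕ.≤ K
  ∣potential∣≤ win = -n≤i≤n⇒∣i∣≤n lower (≤-trans upper (+≤+ wide))
    where open Window win

  BalancingMove : Labeling n → Fin n → Set
  BalancingMove ℓ w =
    (0ℤ ≤ potential ℓ × (∀ x → ℓ x ≡ nothing → localField ℓ w ≤ localField ℓ x)) ⊎
    (potential ℓ < 0ℤ × (∀ x → ℓ x ≡ nothing → localField ℓ x ≤ localField ℓ w))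

  balancingMove : ∀ ℓ {u} → ℓ u ≡ nothing → ∃[ w ] ℓ w ≡ nothing × BalancingMove ℓ w
  balancingMove ℓ ℓu≡nothing with 0ℤ ≤? potential ℓ
  ... | yes 0≤Φ with argmin-unlabeled (localField ℓ) ℓ ℓu≡nothing
  ...   | w , ℓw≡nothing , minimal = w , ℓw≡nothing , inj₁ (0≤Φ , minimal)
  balancingMove ℓ ℓu≡nothing | no Φ≱0 with argmax-unlabeled (localField ℓ) ℓ ℓu≡nothing
  ...   | w , ℓw≡nothing , maximal = w , ℓw≡nothing , inj₂ (≰⇒> Φ≱0 , maximal)

  window-round : ∀ {K} ℓ {w x} → Window K ℓ → ℓ w ≡ nothing → BalancingMove ℓ w →
    setLab ℓ w false x ≡ nothing → Window (2 ℕ.+ K) (setLab (setLab ℓ w false) x true)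
  window-round {K} ℓ {w} {x} win ℓw≡nothing balancing ℓ₁x≡nothing = record
    { wide  = ℕ.≤-trans wide (ℕ.m≤n+m K 2)
    ; lower = subst (- + (2 ℕ.+ K) ≤_) (sym potential≡) (proj₁ step)
    ; upper = subst (_≤ + (4 ℕ.* Δ)) (sym potential≡) (proj₂ step)
    }
    where
    open Window win
    t   = localField ℓ
    t₁x = localField (setLab ℓ w false) x
    potential≡ : potential (setLab (setLab ℓ w false) x true) ≡ potential ℓ + + 2 * (t w - t₁x)
    potential≡ = potential-round ℓ ℓw≡nothing ℓ₁x≡nothing
    ℓx≡nothing : ℓ x ≡ nothing
    ℓx≡nothing = setLab-unlabeled⁻ ℓ w false x ℓ₁x≡nothing
    tx≤t₁x : t x ≤ t₁x
    tx≤t₁x = proj₁ (localField-setLab-false ℓ ℓw≡nothing x)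
    t₁x≤tx+1 : t₁x ≤ t x + 1ℤ
    t₁x≤tx+1 = proj₂ (localField-setLab-false ℓ ℓw≡nothing x)
    towards-zero : BalancingMove ℓ w →
      (0ℤ ≤ potential ℓ × + 2 * (t w - t₁x) ≤ 0ℤ) ⊎ (potential ℓ < 0ℤ × - + 2 ≤ + 2 * (t w - t₁x))
    towards-zero (inj₁ (0≤Φ , minimal)) =
      inj₁ (0≤Φ , *-monoˡ-≤-nonNeg (+ 2) (i≤j⇒i-j≤0 (≤-trans (minimal x ℓx≡nothing) tx≤t₁x)))
    towards-zero (inj₂ (Φ<0 , maximal)) =
      inj₂ (Φ<0 , *-monoˡ-≤-nonNeg (+ 2)
                    (j≤i+1⇒-1≤i-j {t w} (≤-trans t₁x≤tx+1 (+-monoˡ-≤ 1ℤ (maximal x ℓx≡nothing)))))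
    step : - + (2 ℕ.+ K) ≤ potential ℓ + + 2 * (t w - t₁x) × potential ℓ + + 2 * (t w - t₁x) ≤ + (4 ℕ.* Δ)
    step = window-step wide lower upper (∣round-increment∣≤ ℓ w x (setLab ℓ w false)) (towards-zero balancing)

  round : ∀ {k K M} ℓ → length (unlabeled ℓ) ≡ 2 ℕ.+ k → Window K ℓ →
    (∀ ℓ′ → length (unlabeled ℓ′) ≡ k → Window (2 ℕ.+ K) ℓ′ → 2 ℕ.* gameValue G k Admirable ℓ′ ℕ.≤ M) →
    2 ℕ.* gameValue G (2 ℕ.+ k) Admirable ℓ ℕ.≤ M
  round {k} {M = M} ℓ #ℓ win next =
    let u , ℓu≡nothing             = unlabeled-vertex ℓ #ℓ
        w , ℓw≡nothing , balancing = balancingMove ℓ ℓu≡nothing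
        ℓ₁                         = setLab ℓ w false
        #ℓ₁                        = length-unlabeled-setLab ℓ false ℓw≡nothing #ℓ
        u₁ , ℓ₁u₁≡nothing          = unlabeled-vertex ℓ₁ #ℓ₁
        x , ℓ₁x≡nothing , impish≡  = gameValue-Impish-attained G k ℓ₁ ℓ₁u₁≡nothing
        ℓ₂                         = setLab ℓ₁ x true
    in begin
      2 ℕ.* gameValue G (2 ℕ.+ k) Admirable ℓ  ≤⟨ ℕ.*-monoʳ-≤ 2 (gameValue-Admirable-≤ G (suc k) ℓ ℓw≡nothing) ⟩
      2 ℕ.* gameValue G (suc k) Impish ℓ₁      ≡⟨ cong (2 ℕ.*_) impish≡ ⟩
      2 ℕ.* gameValue G k Admirable ℓ₂         ≤⟨ next ℓ₂ (length-unlabeled-setLab ℓ₁ true ℓ₁x≡nothing #ℓ₁)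
                                                          (window-round ℓ win ℓw≡nothing balancing ℓ₁x≡nothing) ⟩
      M                                        ∎
    where open ℕ.≤-Reasoning

  admirable-even : ∀ k {K} ℓ → Even k → length (unlabeled ℓ) ≡ k → Window K ℓ →
    2 ℕ.* gameValue G k Admirable ℓ ℕ.≤ K ℕ.+ k
  admirable-even zero {K} ℓ _ #ℓ win = begin
    2 ℕ.* discrepancy G ℓ  ≡⟨ double-discrepancy ℓ (length-unlabeled≡0⇒complete ℓ #ℓ) ⟩
    ∣ potential ℓ ∣        ≤⟨ ∣potential∣≤ win ⟩
    K                      ≤⟨ ℕ.m≤m+n K 0 ⟩
    K ℕ.+ 0                ∎
    where open ℕ.≤-Reasoning
  admirable-even (suc zero) ℓ ()
  admirable-even (suc (suc k)) {K} ℓ even #ℓ win = round ℓ #ℓ win λ ℓ′ #ℓ′ win′ →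
    subst (2 ℕ.* gameValue G k Admirable ℓ′ ℕ.≤_) (shift K k) (admirable-even k ℓ′ even #ℓ′ win′)
    where
    shift : ∀ K k → 2 ℕ.+ K ℕ.+ k ≡ K ℕ.+ (2 ℕ.+ k)
    shift = ℕ-Solver.solve-∀

  admirable-odd : ∀ k {K} ℓ → Odd k → length (unlabeled ℓ) ≡ k → Window K ℓ →
    2 ℕ.* gameValue G k Admirable ℓ ℕ.≤ K ℕ.+ k ℕ.+ 2 ℕ.* Δ
  admirable-odd zero ℓ ()
  admirable-odd (suc zero) {K} ℓ _ #ℓ win =
    let w , ℓw≡nothing = unlabeled-vertex ℓ #ℓ
        ℓ₁             = setLab ℓ w false
        complete       = length-unlabeled≡0⇒complete ℓ₁ (length-unlabeled-setLab ℓ false ℓw≡nothing #ℓ)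
    in begin
      2 ℕ.* gameValue G 1 Admirable ℓ  ≤⟨ ℕ.*-monoʳ-≤ 2 (gameValue-Admirable-≤ G 0 ℓ ℓw≡nothing) ⟩
      2 ℕ.* discrepancy G ℓ₁           ≡⟨ double-discrepancy ℓ₁ complete ⟩
      ∣ potential ℓ₁ ∣                 ≤⟨ ∣potential-setLab∣≤ ℓ false ℓw≡nothing ⟩
      ∣ potential ℓ ∣ ℕ.+ 2 ℕ.* Δ      ≤⟨ ℕ.+-monoˡ-≤ (2 ℕ.* Δ) (ℕ.≤-trans (∣potential∣≤ win) (ℕ.m≤m+n K 1)) ⟩
      K ℕ.+ 1 ℕ.+ 2 ℕ.* Δ              ∎
    where open ℕ.≤-Reasoning
  admirable-odd (suc (suc k)) {K} ℓ odd #ℓ win = round ℓ #ℓ win λ ℓ′ #ℓ′ win′ →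
    subst (2 ℕ.* gameValue G k Admirable ℓ′ ℕ.≤_) (shift K k Δ) (admirable-odd k ℓ′ odd #ℓ′ win′)
    where
    shift : ∀ K k D → 2 ℕ.+ K ℕ.+ k ℕ.+ 2 ℕ.* D ≡ K ℕ.+ (2 ℕ.+ k) ℕ.+ 2 ℕ.* D
    shift = ℕ-Solver.solve-∀

  cgA-even : Even n → 2 ℕ.* cgA G ℕ.≤ n ℕ.+ 4 ℕ.* Δ
  cgA-even even = subst (2 ℕ.* cgA G ℕ.≤_) (ℕ.+-comm (4 ℕ.* Δ) n)
    (admirable-even n emptyLab even length-unlabeled-emptyLab (window-start emptyLab potential-emptyLab))

  cgA-odd : Odd n → 2 ℕ.* cgA G ℕ.≤ n ℕ.+ 6 ℕ.* Δ
  cgA-odd odd = subst (2 ℕ.* cgA G ℕ.≤_) (regroup n Δ)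
    (admirable-odd n emptyLab odd length-unlabeled-emptyLab (window-start emptyLab potential-emptyLab))
    where
    regroup : ∀ n D → 4 ℕ.* D ℕ.+ n ℕ.+ 2 ℕ.* D ≡ n ℕ.+ 6 ℕ.* D
    regroup = ℕ-Solver.solve-∀

even-suc⇒odd : ∀ m → Even (suc m) → Odd m
even-suc⇒odd zero          ()
even-suc⇒odd (suc zero)    _    = refl
even-suc⇒odd (suc (suc m)) even = even-suc⇒odd m even

odd-suc⇒even : ∀ m → Odd (suc m) → Even m
odd-suc⇒even zero          _   = refl
odd-suc⇒even (suc zero)    ()
odd-suc⇒even (suc (suc m)) odd = odd-suc⇒even m odd

impish-first-move : ∀ {m} (G : Graph (suc m)) →
  ∃[ ℓ ] length (unlabeled ℓ) ≡ m × Potential.potential G ℓ ≡ 0ℤ × cgI G ≡ gameValue G m Admirable ℓ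
impish-first-move {m} G with gameValue-Impish-attained G m emptyLab {zero} refl
... | x , _ , value≡ =
  setLab emptyLab x true ,
  length-unlabeled-setLab emptyLab {x} true refl length-unlabeled-emptyLab ,
  Potential.potential-setLab-emptyLab G x true ,
  value≡

cgI-even : ∀ {n} (G : Graph n) → Even n → 2 ℕ.* cgI G ℕ.≤ n ℕ.+ 6 ℕ.* maxDegree G
cgI-even {zero}  G even = ℕ.≤-trans (Strategy.cgA-even G even) (ℕ.*-monoˡ-≤ (maxDegree G) (ℕ.m≤m+n 4 2))
cgI-even {suc m} G even =
  let ℓ , #ℓ , Φ≡0 , cgI≡ = impish-first-move G
  in begin
    2 ℕ.* cgI G                      ≡⟨ cong (2 ℕ.*_) cgI≡ ⟩
    2 ℕ.* gameValue G m Admirable ℓ  ≤⟨ admirable-odd m ℓ (even-suc⇒odd m even) #ℓ (window-start ℓ Φ≡0) ⟩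
    4 ℕ.* Δ ℕ.+ m ℕ.+ 2 ℕ.* Δ        ≡⟨ regroup m Δ ⟩
    m ℕ.+ 6 ℕ.* Δ                    ≤⟨ ℕ.n≤1+n _ ⟩
    suc m ℕ.+ 6 ℕ.* Δ                ∎
  where
  open Strategy G
  open ℕ.≤-Reasoning
  regroup : ∀ m D → 4 ℕ.* D ℕ.+ m ℕ.+ 2 ℕ.* D ≡ m ℕ.+ 6 ℕ.* D
  regroup = ℕ-Solver.solve-∀

cgI-odd : ∀ {n} (G : Graph n) → Odd n → 2 ℕ.* cgI G ℕ.≤ n ℕ.+ 4 ℕ.* maxDegree G
cgI-odd {suc m} G odd =
  let ℓ , #ℓ , Φ≡0 , cgI≡ = impish-first-move G
  in begin
    2 ℕ.* cgI G                      ≡⟨ cong (2 ℕ.*_) cgI≡ ⟩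
    2 ℕ.* gameValue G m Admirable ℓ  ≤⟨ admirable-even m ℓ (odd-suc⇒even m odd) #ℓ (window-start ℓ Φ≡0) ⟩
    4 ℕ.* Δ ℕ.+ m                    ≡⟨ ℕ.+-comm (4 ℕ.* Δ) m ⟩
    m ℕ.+ 4 ℕ.* Δ                    ≤⟨ ℕ.n≤1+n _ ⟩
    suc m ℕ.+ 4 ℕ.* Δ                ∎
  where
  open Strategy G
  open ℕ.≤-Reasoning

theorem5p2 : ∀ (n : ℕ) (G : Graph n) →
    (Even n → (2 ℕ.* cgA G ℕ.≤ n ℕ.+ 4 ℕ.* maxDegree G) × (2 ℕ.* cgI G ℕ.≤ n ℕ.+ 6 ℕ.* maxDegree G)) ×
    (Odd n → (2 ℕ.* cgA G ℕ.≤ n ℕ.+ 6 ℕ.* maxDegree G) × (2 ℕ.* cgI G ℕ.≤ n ℕ.+ 4 ℕ.* maxDegree G))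
theorem5p2 n G =
  (λ even → Strategy.cgA-even G even , cgI-even G even) ,
  (λ odd  → Strategy.cgA-odd G odd , cgI-odd G odd)
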